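{- Let $n\geq 1$ and $S,T\subseteq[n-1]$, and let $$A_{ST}=\#\{w\in\mathfrak{S}_n : \overline{S}\subseteq C(w),\ T\subseteq D(w)\}.$$ Then $A_{ST}=\eta(\overline{S})/\eta(\overline{T})$ if $\overline{S}\cap T=\emptyset$, and $A_{ST}=0$ otherwise.
   Context: $[n]=\{1,\dots,n\}$, $\mathfrak{S}_n$ is the set of permutations $w=a_1\cdots a_n$ of $[n]$. For $X\subseteq[n-1]$, $\overline{X}=[n-1]\setminus X$. The descent set is $D(w)=\{i : a_i>a_{i+1}\}$. The connectivity set is $C(w)=\{i\in[n-1] : a_j<a_k \text{ for all } j\leq i<k\}$. For $X=\{i_1<\cdots<i_k\}\subseteq[n-1]$, $\eta(X)=i_1!\,(i_2-i_1)!\cdots(i_k-i_{k-1})!\,(n-i_k)!$ (with $\eta(\emptyset)=n!$). -}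

module Defs where

open import Data.Nat as ℕ using (ℕ; zero; suc; _*_)
open import Data.Nat using (_!; NonZero)
open import Data.Fin as Fin using (Fin; zero; suc; toℕ; inject₁)
open import Data.Fin.Properties using (all?; _≟_; _<?_)
import Data.Nat.Properties as ℕP
open import Data.Fin.Subset using (Subset; _∈_; ∁; outside; inside)
open import Data.Fin.Subset.Properties using (_∈?_)
open import Data.Vec using (Vec; []; _∷_; lookup)
open import Data.List using (List; []; _∷_; concatMap; map; filter; length; allFin)
open import Data.Product using (_×_)
open import Relation.Binary.PropositionalEquality using (_≡_)
open import Relation.Nullary using (Dec; yes; no)
open import Relation.Nullary.Decidable using (_×-dec_; _→-dec_)

-- A permutation w = a₁⋯aₙ of [n] is encoded as a vector of length n over Fin n
-- (position i ↦ a_{i+1}, value k ↦ k+1) whose entries are pairwise distinct.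

IsPerm : ∀ {n} → Vec (Fin n) n → Set
IsPerm {n} w = ∀ (i j : Fin n) → lookup w i ≡ lookup w j → i ≡ j

isPerm? : ∀ {n} (w : Vec (Fin n) n) → Dec (IsPerm w)
isPerm? w = all? λ i → all? λ j → (lookup w i ≟ lookup w j) →-dec (i ≟ j)

allVecs : ∀ {n} (k : ℕ) → List (Vec (Fin n) k)
allVecs zero    = [] ∷ []
allVecs {n} (suc k) = concatMap (λ x → map (x ∷_) (allVecs k)) (allFin n)

-- Throughout n = suc m, and j : Fin m stands for the element toℕ j + 1 of [n-1].

Descent : ∀ {m} → Vec (Fin (suc m)) (suc m) → Fin m → Set
Descent w j = lookup w (suc j) Fin.< lookup w (inject₁ j)

descent? : ∀ {m} (w : Vec (Fin (suc m)) (suc m)) (j : Fin m) → Dec (Descent w j)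
descent? w j = lookup w (suc j) <? lookup w (inject₁ j)

Connect : ∀ {m} → Vec (Fin (suc m)) (suc m) → Fin m → Set
Connect {m} w j = ∀ (p q : Fin (suc m)) → toℕ p ℕ.≤ toℕ j → toℕ j ℕ.< toℕ q →
                  lookup w p Fin.< lookup w q

connect? : ∀ {m} (w : Vec (Fin (suc m)) (suc m)) (j : Fin m) → Dec (Connect w j)
connect? w j = all? λ p → all? λ q →
  (toℕ p ℕP.≤? toℕ j) →-dec ((toℕ j ℕP.<? toℕ q) →-dec (lookup w p <? lookup w q))

Cond : ∀ {m} → Subset m → Subset m → Vec (Fin (suc m)) (suc m) → Set
Cond {m} S T w = (∀ (j : Fin m) → j ∈ ∁ S → Connect w j) × (∀ (j : Fin m) → j ∈ T → Descent w j)

cond? : ∀ {m} (S T : Subset m) (w : Vec (Fin (suc m)) (suc m)) → Dec (Cond S T w)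
cond? S T w = (all? λ j → (j ∈? ∁ S) →-dec connect? w j) ×-dec (all? λ j → (j ∈? T) →-dec descent? w j)

permCond? : ∀ {m} (S T : Subset m) (w : Vec (Fin (suc m)) (suc m)) → Dec (IsPerm w × Cond S T w)
permCond? S T w = isPerm? w ×-dec cond? S T w

A : ∀ {m} → Subset m → Subset m → ℕ
A {m} S T = length (filter (permCond? S T) (allVecs (suc m)))

-- η(X) for X ⊆ [n-1], n = suc m: product of factorials of the gaps
-- i₁, i₂ - i₁, …, n - i_k.  `run` is the length of the current gap so far.
etaAux : ∀ {k} → Subset k → ℕ → ℕ
etaAux []             run = run !
etaAux (inside  ∷ xs) run = (run !) * etaAux xs 1
etaAux (outside ∷ xs) run = etaAux xs (suc run)

η : ∀ {m} → Subset m → ℕ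
η X = etaAux X 1

-- η is always nonzero (needed so that ℕ-division by η is defined)
etaAux-nonZero : ∀ {k} (X : Subset k) (run : ℕ) → NonZero (etaAux X run)
etaAux-nonZero []             run = ℕP._!≢0 run
etaAux-nonZero (inside  ∷ xs) run =
  ℕP.m*n≢0 (run !) (etaAux xs 1) {{ℕP._!≢0 run}} {{etaAux-nonZero xs 1}}
etaAux-nonZero (outside ∷ xs) run = etaAux-nonZero xs (suc run)

η-nonZero : ∀ {m} (X : Subset m) → NonZero (η X)
η-nonZero X = etaAux-nonZero X 1

{-# OPTIONS --safe #-}
module Submission where

-- For a permutation w = a₁⋯aₙ, i ∈ C(w) iff {a₁,…,aᵢ} = {1,…,i}.  So S̄ ⊆ C(w) says that
-- aₚ ≤ cₚ for every p, where cₚ is the least element of S̄ ∪ {n} that is ≥ p, and T ⊆ D(w) says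
-- that w decreases along the runs of positions linked by T.  If S̄ ∩ T = ∅, all positions of a
-- run have the same bound c.  Filling w from left to right, a run of length r with bound c that
-- follows s filled positions is a decreasing choice of r among the c − s values ≤ c still
-- free; hence A_ST · ∏ r! = ∏ₚ (cₚ − p + 1) = η(S̄), while ∏ r! = η(T̄).  Counting left to right
-- needs a hockey-stick identity, as the later entries of a run depend on its first entry.
-- If j ∈ S̄ ∩ T, then j ∈ C(w) and j ∈ D(w) contradict each other, so A_ST = 0.

open import Defs
open import Data.Bool using (Bool; true; false; _∧_; not; if_then_else_; T)
open import Data.Bool.Properties using (T-≡; T-∧)
open import Data.Empty using (⊥-elim)
open import Data.Fin as Fin using (Fin; zero; suc; toℕ; inject₁)
open import Data.Fin.Properties
  using (_≟_; toℕ<n; toℕ-fromℕ<; toℕ-injective; toℕ-inject₁; injective⇒≤; join-splitAt)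
open import Data.Fin.Subset using (Subset; ∁; _∩_; _∈_; Empty; Nonempty)
open import Data.Fin.Subset.Properties using (nonempty?; p∩q⊆p; p∩q⊆q)
open import Data.List using (List; []; _∷_; _++_; length; filter; map; concat; tabulate)
open import Data.List.Properties using (filter-++; length-++; filter-≐; filter-none)
import Data.List.Relation.Unary.All as List
open import Data.Nat
  using (ℕ; zero; suc; pred; _+_; _*_; _∸_; _!; _≤_; _<_; _<ᵇ_; z≤n; s≤s; s≤s⁻¹; _≤?_; _<?_)
open import Data.Nat.DivMod using (_/_; m*n/n≡m)
open import Data.Nat.Properties
  using ( +-*-semiring; +-assoc; +-comm; +-identityʳ; +-suc; +-cancelˡ-≡; +-monoʳ-<
        ; *-zeroʳ; *-identityˡ; *-assoc; *-comm; *-cancelʳ-≡; _!≢0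
        ; ≤-refl; ≤-reflexive; ≤-trans; <-≤-trans; ≤-<-trans; <⇒≤; <⇒≱; ≰⇒>; ≮⇒≥; <-asym
        ; m≤m+n; m<n⇒m<1+n; m+1+n≰m; m+[n∸m]≡n; m+n∸m≡n; ∸-monoˡ-<; ∸-cancelʳ-≡
        ; pred[m∸n]≡m∸[1+n]; <ᵇ⇒<; <⇒<ᵇ )
open import Data.Nat.Solver using (module +-*-Solver)
open import Data.Product using (_×_; _,_; proj₁; proj₂)
open import Data.Sum using (_⊎_; inj₁; inj₂)
open import Data.Unit using (⊤; tt)
open import Data.Vec as Vec using (Vec; []; _∷_; lookup; here; there)
open import Data.Vec.Properties using (lookup-map; tabulate∘lookup)
open import Data.Vec.Relation.Unary.All as All using (All; []; _∷_)
import Data.Vec.Relation.Unary.All.Properties as All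
open import Data.Vec.Relation.Unary.AllPairs as AllPairs using (AllPairs; []; _∷_)
import Data.Vec.Relation.Unary.AllPairs.Properties as AllPairs
open import Data.Vec.Relation.Unary.Unique.Propositional using (Unique)
open import Data.Vec.Relation.Unary.Unique.Propositional.Properties using (lookup-injective; tabulate⁺)
open import Function using (_∘_)
open import Function.Bundles using (Equivalence; _⇔_; mk⇔)
open import Relation.Binary.PropositionalEquality
open import Relation.Nullary using (¬_; Dec; yes; no; does)
open import Relation.Nullary.Decidable using (T?; decidable-stable)
open import Algebra.Properties.Semiring.Sum +-*-semiring
  using (sum; sum-cong-≗; sum-replicate-zero; ∑-distrib-+; *-distribʳ-sum)

open ≡-Reasoning
open +-*-Solver

infixr 8 _↓_

_↓_ : ℕ → ℕ → ℕ
n     ↓ zero  = 1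
zero  ↓ suc k = 0
suc n ↓ suc k = suc n * (n ↓ k)

↓-suc : ∀ n k → n ↓ suc k ≡ n * (pred n ↓ k)
↓-suc zero    k = refl
↓-suc (suc n) k = refl

suc-↓-suc : ∀ n k → suc k * (n ↓ k) + n ↓ suc k ≡ suc n ↓ suc k
suc-↓-suc zero    zero    = refl
suc-↓-suc zero    (suc k) = trans (+-identityʳ _) (*-zeroʳ (suc (suc k)))
suc-↓-suc (suc n) zero    = refl
suc-↓-suc (suc n) (suc k) = begin
  suc (suc k) * (suc n * x) + suc n * y
    ≡⟨ solve 4 (λ n k x y → (con 2 :+ k) :* ((con 1 :+ n) :* x) :+ (con 1 :+ n) :* y
                         := (con 1 :+ n) :* x :+ (con 1 :+ n) :* ((con 1 :+ k) :* x :+ y)) refl n k x y ⟩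
  suc n * x + suc n * (suc k * x + y)
    ≡⟨ cong (λ z → suc n * x + suc n * z) (suc-↓-suc n k) ⟩
  suc n * x + suc n * (suc n * x)
    ≡⟨ solve 2 (λ n x → (con 1 :+ n) :* x :+ (con 1 :+ n) :* ((con 1 :+ n) :* x)
                     := (con 2 :+ n) :* ((con 1 :+ n) :* x)) refl n x ⟩
  suc (suc n) * (suc n * x) ∎
  where x = n ↓ k; y = n ↓ suc k

-- Available values below a bound

countBelow : ∀ {N} → (Fin N → Bool) → ℕ → ℕ
countBelow R B = sum λ y → if (toℕ y <ᵇ B) ∧ R y then 1 else 0

countBelow-zero : ∀ {N} (R : Fin N → Bool) → countBelow R 0 ≡ 0
countBelow-zero {N} R = sum-replicate-zero N

countBelow-full : ∀ N c → c ≤ N → countBelow {N} (λ _ → true) c ≡ c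
countBelow-full N       zero    _         = countBelow-zero {N} (λ _ → true)
countBelow-full (suc N) (suc c) (s≤s c≤N) = cong suc (countBelow-full N c c≤N)

_─_ : ∀ {N} → (Fin N → Bool) → Fin N → Fin N → Bool
(R ─ x) y = not (does (x ≟ y)) ∧ R y

T-─ : ∀ {N} (R : Fin N → Bool) x y → T ((R ─ x) y) ⇔ (x ≢ y × T (R y))
T-─ R x y = by-cases (x ≟ y)
  where
  by-cases : (d : Dec (x ≡ y)) → T (not (does d) ∧ R y) ⇔ (x ≢ y × T (R y))
  by-cases (yes refl) = mk⇔ (λ ()) (λ (x≢x , _) → ⊥-elim (x≢x refl))
  by-cases (no x≢y)   = mk⇔ (x≢y ,_) proj₂

sum-δ : ∀ {N} (x : Fin N) a → sum (λ y → if does (x ≟ y) then a else 0) ≡ a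
sum-δ {suc N} zero    a = trans (cong (a +_) (sum-replicate-zero N)) (+-identityʳ a)
sum-δ {suc N} (suc x) a = sum-δ x a

countBelow-─ : ∀ {N} (R : Fin N → Bool) x B →
  countBelow R B ≡ countBelow (R ─ x) B + (if (toℕ x <ᵇ B) ∧ R x then 1 else 0)
countBelow-─ R x B = begin
  countBelow R B
    ≡⟨ sum-cong-≗ (λ y → split (x ≟ y)) ⟩
  sum (λ y → (if (toℕ y <ᵇ B) ∧ (R ─ x) y then 1 else 0) + (if does (x ≟ y) then [x] else 0))
    ≡⟨ ∑-distrib-+ (λ y → if (toℕ y <ᵇ B) ∧ (R ─ x) y then 1 else 0) (λ y → if does (x ≟ y) then [x] else 0) ⟩
  countBelow (R ─ x) B + sum (λ y → if does (x ≟ y) then [x] else 0)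
    ≡⟨ cong (countBelow (R ─ x) B +_) (sum-δ x [x]) ⟩
  countBelow (R ─ x) B + [x] ∎
  where
  [x] = if (toℕ x <ᵇ B) ∧ R x then 1 else 0
  split : ∀ {y} (d : Dec (x ≡ y)) →
    (if (toℕ y <ᵇ B) ∧ R y then 1 else 0) ≡
    (if (toℕ y <ᵇ B) ∧ (not (does d) ∧ R y) then 1 else 0) + (if does d then [x] else 0)
  split (yes refl) with toℕ x <ᵇ B | R x
  ... | true  | true  = refl
  ... | true  | false = refl
  ... | false | _     = refl
  split (no _) = sym (+-identityʳ _)

<ᵇ-irrefl : ∀ n → (n <ᵇ n) ≡ false
<ᵇ-irrefl zero    = refl
<ᵇ-irrefl (suc n) = <ᵇ-irrefl n

countBelow-─-self : ∀ {N} (R : Fin N → Bool) x → countBelow (R ─ x) (toℕ x) ≡ countBelow R (toℕ x)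
countBelow-─-self R x = sym (begin
  countBelow R (toℕ x)
    ≡⟨ countBelow-─ R x (toℕ x) ⟩
  countBelow (R ─ x) (toℕ x) + (if (toℕ x <ᵇ toℕ x) ∧ R x then 1 else 0)
    ≡⟨ cong (λ b → countBelow (R ─ x) (toℕ x) + (if b ∧ R x then 1 else 0)) (<ᵇ-irrefl (toℕ x)) ⟩
  countBelow (R ─ x) (toℕ x) + 0
    ≡⟨ +-identityʳ _ ⟩
  countBelow (R ─ x) (toℕ x) ∎)

countBelow-─-above : ∀ {N} (R : Fin N → Bool) x B → toℕ x < B → T (R x) →
  countBelow R B ≡ suc (countBelow (R ─ x) B)
countBelow-─-above R x B x<B Rx = begin
  countBelow R B
    ≡⟨ countBelow-─ R x B ⟩
  countBelow (R ─ x) B + (if (toℕ x <ᵇ B) ∧ R x then 1 else 0)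
    ≡⟨ cong (λ b → countBelow (R ─ x) B + (if b then 1 else 0))
            (Equivalence.to T-≡ (Equivalence.from T-∧ (<⇒<ᵇ x<B , Rx))) ⟩
  countBelow (R ─ x) B + 1
    ≡⟨ +-comm _ 1 ⟩
  suc (countBelow (R ─ x) B) ∎

hockey-stick : ∀ {N} (R : Fin N → Bool) q B →
  suc q * sum (λ x → if (toℕ x <ᵇ B) ∧ R x then countBelow R (toℕ x) ↓ q else 0)
    ≡ countBelow R B ↓ suc q
hockey-stick R q B = trans (sym (+-identityʳ _)) (with-offset R B 0)
  where
  pascal : ∀ r a → suc q * (if r then a ↓ q else 0) + a ↓ suc q ≡ (a + (if r then 1 else 0)) ↓ suc q
  pascal true  a = trans (suc-↓-suc a q) (cong (_↓ suc q) (+-comm 1 a))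
  pascal false a = cong₂ (λ u v → u + v ↓ suc q) (*-zeroʳ (suc q)) (sym (+-identityʳ a))

  with-offset : ∀ {N} (R : Fin N → Bool) B a →
    suc q * sum (λ x → if (toℕ x <ᵇ B) ∧ R x then (a + countBelow R (toℕ x)) ↓ q else 0) + a ↓ suc q
      ≡ (a + countBelow R B) ↓ suc q
  with-offset {zero}  R B       a = pascal false a
  with-offset {suc N} R zero    a = cong₂ (λ u v → u + v ↓ suc q)
    (trans (cong (suc q *_) (sum-replicate-zero (suc N))) (*-zeroʳ (suc q)))
    (sym (trans (cong (a +_) (countBelow-zero R)) (+-identityʳ a)))
  with-offset {suc N} R (suc B) a = begin
    suc q * (h + sum t) + a ↓ suc q
      ≡⟨ solve 4 (λ q h t z → (con 1 :+ q) :* (h :+ t) :+ z := ((con 1 :+ q) :* h :+ z) :+ (con 1 :+ q) :* t)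
                 refl q h (sum t) (a ↓ suc q) ⟩
    (suc q * h + a ↓ suc q) + suc q * sum t
      ≡⟨ cong₂ (λ u v → u + suc q * v) first (sum-cong-≗ λ x →
           cong (λ z → if (toℕ x <ᵇ B) ∧ R (suc x) then z ↓ q else 0) (sym (+-assoc a δ _))) ⟩
    (a + δ) ↓ suc q + suc q * sum t′
      ≡⟨ +-comm ((a + δ) ↓ suc q) _ ⟩
    suc q * sum t′ + (a + δ) ↓ suc q
      ≡⟨ with-offset (R ∘ suc) B (a + δ) ⟩
    (a + δ + countBelow (R ∘ suc) B) ↓ suc q
      ≡⟨ cong (_↓ suc q) (+-assoc a δ _) ⟩
    (a + countBelow R (suc B)) ↓ suc q ∎
    where
    δ = if R zero then 1 else 0
    h = if R zero then (a + countBelow R 0) ↓ q else 0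
    t = λ x → if (toℕ x <ᵇ B) ∧ R (suc x) then (a + (δ + countBelow (R ∘ suc) (toℕ x))) ↓ q else 0
    t′ = λ x → if (toℕ x <ᵇ B) ∧ R (suc x) then (a + δ + countBelow (R ∘ suc) (toℕ x)) ↓ q else 0
    first : suc q * h + a ↓ suc q ≡ (a + δ) ↓ suc q
    first = trans (cong (λ z → suc q * (if R zero then z ↓ q else 0) + a ↓ suc q)
                        (trans (cong (a +_) (countBelow-zero R)) (+-identityʳ a)))
                  (pascal (R zero) a)

-- Counting admissible vectors

count : ∀ {A : Set} → (A → Bool) → List A → ℕ
count p xs = length (filter (T? ∘ p) xs)

count-++ : ∀ {A : Set} (p : A → Bool) xs ys → count p (xs ++ ys) ≡ count p xs + count p ys
count-++ p xs ys = trans (cong length (filter-++ (T? ∘ p) xs ys)) (length-++ (filter (T? ∘ p) xs))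

count-map : ∀ {A B : Set} (p : B → Bool) (f : A → B) xs → count p (map f xs) ≡ count (p ∘ f) xs
count-map p f []       = refl
count-map p f (x ∷ xs) with p (f x)
... | true  = cong suc (count-map p f xs)
... | false = count-map p f xs

count-∧ : ∀ {A : Set} b (q : A → Bool) xs → count (λ x → b ∧ q x) xs ≡ (if b then count q xs else 0)
count-∧ true  q xs       = refl
count-∧ false q []       = refl
count-∧ false q (x ∷ xs) = count-∧ false q xs

count-concat-tabulate : ∀ {A B : Set} {N} (p : B → Bool) (g : A → List B) (h : Fin N → A) →
  count p (concat (map g (tabulate h))) ≡ sum (λ i → count p (g (h i)))
count-concat-tabulate {N = zero}  p g h = refl
count-concat-tabulate {N = suc N} p g h =
  trans (count-++ p (g (h zero)) _) (cong (count p (g (h zero)) +_) (count-concat-tabulate p g (h ∘ suc)))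

count-allVecs : ∀ {N k} (p : Vec (Fin N) (suc k) → Bool) →
  count p (allVecs (suc k)) ≡ sum (λ x → count (p ∘ (x ∷_)) (allVecs k))
count-allVecs {k = k} p = trans (count-concat-tabulate p (λ x → map (x ∷_) (allVecs k)) (λ x → x))
                                (sum-cong-≗ λ x → count-map p (x ∷_) (allVecs k))

-- A shape consists of bounds cs and links ls.  The entry at a linked position must be smaller
-- than the previous entry (initially prev), any other entry smaller than its bound; entries are
-- drawn without repetition from R.

limit : Bool → ℕ → ℕ → ℕ
limit l prev c = if l then prev else c

limit-elim : ∀ (P : ℕ → Set) l {prev c} → P prev → P c → P (limit l prev c)
limit-elim P true  p _ = p
limit-elim P false _ q = q

admissible : ∀ {N k} → (Fin N → Bool) → ℕ → Vec ℕ k → Vec Bool k → Vec (Fin N) k → Bool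
admissible R prev []       []       []      = true
admissible R prev (c ∷ cs) (l ∷ ls) (x ∷ v) =
  ((toℕ x <ᵇ limit l prev c) ∧ R x) ∧ admissible (R ─ x) (toℕ x) cs ls v

#admissible : ∀ {N k} → (Fin N → Bool) → ℕ → Vec ℕ k → Vec Bool k → ℕ
#admissible {k = k} R prev cs ls = count (admissible R prev cs ls) (allVecs k)

#admissible-step : ∀ {N k} (R : Fin N → Bool) prev c l (cs : Vec ℕ k) ls →
  #admissible R prev (c ∷ cs) (l ∷ ls) ≡
  sum (λ x → if (toℕ x <ᵇ limit l prev c) ∧ R x then #admissible (R ─ x) (toℕ x) cs ls else 0)
#admissible-step {k = k} R prev c l cs ls =
  trans (count-allVecs (admissible R prev (c ∷ cs) (l ∷ ls)))
        (sum-cong-≗ λ x → count-∧ ((toℕ x <ᵇ limit l prev c) ∧ R x)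
                                   (admissible (R ─ x) (toℕ x) cs ls) (allVecs k))

leadingTrues : ∀ {k} → Vec Bool k → ℕ
leadingTrues []           = 0
leadingTrues (true  ∷ bs) = suc (leadingTrues bs)
leadingTrues (false ∷ bs) = 0

runFactorials : ∀ {k} → Vec Bool k → ℕ
runFactorials []       = 1
runFactorials (_ ∷ bs) = suc (leadingTrues bs) * runFactorials bs

-- κ c counts the available values below c, β is the bound of the current run and s the number
-- of positions already filled.
choices : ∀ {k} → (ℕ → ℕ) → ℕ → ℕ → Vec ℕ k → Vec Bool k → ℕ
choices κ β s []       []       = 1
choices κ β s (c ∷ cs) (l ∷ ls) = (κ (limit l β c) ∸ s) * choices κ (limit l β c) (suc s) cs ls

choicesAfterRun : ∀ {k} → (ℕ → ℕ) → ℕ → Vec ℕ k → Vec Bool k → ℕ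
choicesAfterRun κ s []       []           = 1
choicesAfterRun κ s (c ∷ cs) (true  ∷ ls) = choicesAfterRun κ s cs ls
choicesAfterRun κ s (c ∷ cs) (false ∷ ls) = (κ c ∸ s) * choices κ c (suc s) cs ls

choices-split : ∀ {k} κ β s (cs : Vec ℕ k) ls →
  choices κ β s cs ls ≡ (κ β ∸ s) ↓ leadingTrues ls * choicesAfterRun κ (s + leadingTrues ls) cs ls
choices-split κ β s []       []           = refl
choices-split κ β s (c ∷ cs) (false ∷ ls) =
  sym (trans (*-identityˡ _) (cong (λ t → (κ c ∸ t) * choices κ c (suc t) cs ls) (+-identityʳ s)))
choices-split κ β s (c ∷ cs) (true  ∷ ls) = begin
  (κ β ∸ s) * choices κ β (suc s) cs ls
    ≡⟨ cong ((κ β ∸ s) *_) (choices-split κ β (suc s) cs ls) ⟩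
  (κ β ∸ s) * ((κ β ∸ suc s) ↓ r * choicesAfterRun κ (suc s + r) cs ls)
    ≡⟨ cong₂ (λ u t → (κ β ∸ s) * (u ↓ r * choicesAfterRun κ t cs ls))
             (sym (pred[m∸n]≡m∸[1+n] (κ β) s)) (sym (+-suc s r)) ⟩
  (κ β ∸ s) * (pred (κ β ∸ s) ↓ r * choicesAfterRun κ (s + suc r) cs ls)
    ≡⟨ sym (*-assoc (κ β ∸ s) _ _) ⟩
  (κ β ∸ s) * pred (κ β ∸ s) ↓ r * choicesAfterRun κ (s + suc r) cs ls
    ≡⟨ cong (_* choicesAfterRun κ (s + suc r) cs ls) (sym (↓-suc (κ β ∸ s) r)) ⟩
  (κ β ∸ s) ↓ suc r * choicesAfterRun κ (s + suc r) cs ls ∎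
  where r = leadingTrues ls

choices-firstRun : ∀ {k} κ β c l (cs : Vec ℕ k) ls →
  choices κ β 0 (c ∷ cs) (l ∷ ls) ≡
  κ (limit l β c) ↓ suc (leadingTrues ls) * choicesAfterRun κ (suc (leadingTrues ls)) cs ls
choices-firstRun κ β c l cs ls = begin
  κ β′ * choices κ β′ 1 cs ls
    ≡⟨ cong (κ β′ *_) (choices-split κ β′ 1 cs ls) ⟩
  κ β′ * ((κ β′ ∸ 1) ↓ r * rest)
    ≡⟨ cong (λ u → κ β′ * (u ↓ r * rest)) (sym (pred[m∸n]≡m∸[1+n] (κ β′) 0)) ⟩
  κ β′ * (pred (κ β′) ↓ r * rest)
    ≡⟨ sym (*-assoc (κ β′) _ rest) ⟩
  κ β′ * pred (κ β′) ↓ r * rest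
    ≡⟨ cong (_* rest) (sym (↓-suc (κ β′) r)) ⟩
  κ β′ ↓ suc r * rest ∎
  where
  β′ = limit l β c
  r = leadingTrues ls
  rest = choicesAfterRun κ (suc r) cs ls

choices-shift : ∀ {k} {κ₁ κ₂ : ℕ → ℕ} β s (cs : Vec ℕ k) ls →
  κ₂ β ≡ suc (κ₁ β) → All (λ c → κ₂ c ≡ suc (κ₁ c)) cs →
  choices κ₁ β s cs ls ≡ choices κ₂ β (suc s) cs ls
choices-shift β s []       []       _  []         = refl
choices-shift {κ₁ = κ₁} {κ₂} β s (c ∷ cs) (l ∷ ls) eβ (ec ∷ ecs) =
  cong₂ _*_ (cong (_∸ suc s) (sym e)) (choices-shift (limit l β c) (suc s) cs ls e ecs)
  where e = limit-elim (λ b → κ₂ b ≡ suc (κ₁ b)) l eβ ec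

choicesAfterRun-shift : ∀ {k} {κ₁ κ₂ : ℕ → ℕ} s (cs : Vec ℕ k) ls →
  All (λ c → κ₂ c ≡ suc (κ₁ c)) cs → choicesAfterRun κ₁ s cs ls ≡ choicesAfterRun κ₂ (suc s) cs ls
choicesAfterRun-shift s []       []           []         = refl
choicesAfterRun-shift s (c ∷ cs) (true  ∷ ls) (_  ∷ ecs) = choicesAfterRun-shift s cs ls ecs
choicesAfterRun-shift s (c ∷ cs) (false ∷ ls) (ec ∷ ecs) =
  cong₂ _*_ (cong (_∸ suc s) (sym ec)) (choices-shift c (suc s) cs ls ec ecs)

sorted-limit : ∀ {k} l {prev c} {cs : Vec ℕ k} →
  AllPairs _≤_ (prev ∷ c ∷ cs) → AllPairs _≤_ (limit l prev c ∷ cs)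
sorted-limit l ((_ ∷ prev≤cs) ∷ (c≤cs ∷ sorted)) = limit-elim (λ b → All (b ≤_) _) l prev≤cs c≤cs ∷ sorted

sorted-< : ∀ {k x b} {cs : Vec ℕ k} → x < b → AllPairs _≤_ (b ∷ cs) → AllPairs _≤_ (x ∷ cs)
sorted-< x<b (b≤cs ∷ sorted) = All.map (<⇒≤ ∘ <-≤-trans x<b) b≤cs ∷ sorted

if-*-cong : ∀ b {u v m n} → (T b → u * m ≡ v * n) → (if b then u else 0) * m ≡ (if b then v else 0) * n
if-*-cong true  h = h _
if-*-cong false h = refl

#admissible*runFactorials : ∀ {N k} (R : Fin N → Bool) prev (cs : Vec ℕ k) ls → AllPairs _≤_ (prev ∷ cs) →
  #admissible R prev cs ls * runFactorials ls ≡ choices (countBelow R) prev 0 cs ls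
#admissible*runFactorials R prev []       []       _      = refl
#admissible*runFactorials R prev (c ∷ cs) (l ∷ ls) sorted = begin
  #admissible R prev (c ∷ cs) (l ∷ ls) * (suc r * runFactorials ls)
    ≡⟨ cong (_* (suc r * runFactorials ls)) (#admissible-step R prev c l cs ls) ⟩
  sum term * (suc r * runFactorials ls)
    ≡⟨ solve 3 (λ a b d → a :* (b :* d) := b :* (a :* d)) refl (sum term) (suc r) (runFactorials ls) ⟩
  suc r * (sum term * runFactorials ls)
    ≡⟨ cong (suc r *_) (*-distribʳ-sum (runFactorials ls) term) ⟩
  suc r * sum (λ x → term x * runFactorials ls)
    ≡⟨ cong (suc r *_) (sum-cong-≗ λ x → if-*-cong (below x) (starting-with x ∘ Equivalence.to T-∧)) ⟩
  suc r * sum (λ x → (if below x then κ (toℕ x) ↓ r else 0) * rest)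
    ≡⟨ cong (suc r *_) (sym (*-distribʳ-sum rest runStarts)) ⟩
  suc r * (sum runStarts * rest)
    ≡⟨ sym (*-assoc (suc r) (sum runStarts) rest) ⟩
  suc r * sum runStarts * rest
    ≡⟨ cong (_* rest) (hockey-stick R r β) ⟩
  κ β ↓ suc r * rest
    ≡⟨ sym (choices-firstRun κ prev c l cs ls) ⟩
  choices κ prev 0 (c ∷ cs) (l ∷ ls) ∎
  where
  κ = countBelow R
  β = limit l prev c
  r = leadingTrues ls
  rest = choicesAfterRun κ (suc r) cs ls
  below : Fin _ → Bool
  below x = (toℕ x <ᵇ β) ∧ R x
  term = λ x → if below x then #admissible (R ─ x) (toℕ x) cs ls else 0
  runStarts = λ x → if below x then κ (toℕ x) ↓ r else 0
  starting-with : ∀ x → T (toℕ x <ᵇ β) × T (R x) →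
    #admissible (R ─ x) (toℕ x) cs ls * runFactorials ls ≡ κ (toℕ x) ↓ r * rest
  starting-with x (x<ᵇβ , Rx) = begin
    #admissible (R ─ x) (toℕ x) cs ls * runFactorials ls
      ≡⟨ #admissible*runFactorials (R ─ x) (toℕ x) cs ls (sorted-< x<β (sorted-limit l sorted)) ⟩
    choices (countBelow (R ─ x)) (toℕ x) 0 cs ls
      ≡⟨ choices-split (countBelow (R ─ x)) (toℕ x) 0 cs ls ⟩
    countBelow (R ─ x) (toℕ x) ↓ r * choicesAfterRun (countBelow (R ─ x)) r cs ls
      ≡⟨ cong₂ (λ u v → u ↓ r * v) (countBelow-─-self R x) (choicesAfterRun-shift r cs ls shifted) ⟩
    κ (toℕ x) ↓ r * rest ∎
    where
    x<β = <ᵇ⇒< (toℕ x) β x<ᵇβ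
    shifted = All.map (λ β≤c′ → countBelow-─-above R x _ (<-≤-trans x<β β≤c′) Rx)
                      (AllPairs.head (sorted-limit l sorted))

Below : ∀ {N k} → Vec ℕ k → Vec (Fin N) k → Set
Below cs v = ∀ p → toℕ (lookup v p) < lookup cs p

Links : ∀ {N k} → ℕ → Vec Bool k → Vec (Fin N) k → Set
Links prev []       []      = ⊤
Links prev (l ∷ ls) (x ∷ v) = (T l → toℕ x < prev) × Links (toℕ x) ls v

<limit⇒ : ∀ l {x prev c} → prev ≤ c → x < limit l prev c → x < c × (T l → x < prev)
<limit⇒ true  prev≤c x<prev = <-≤-trans x<prev prev≤c , λ _ → x<prev
<limit⇒ false _      x<c    = x<c , λ ()

⇒<limit : ∀ l {x prev c} → x < c → (T l → x < prev) → x < limit l prev c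
⇒<limit true  _   x<prev = x<prev tt
⇒<limit false x<c _      = x<c

-- A linked entry is only compared with its predecessor; sortedness yields its own bound.
admissible⇒ : ∀ {N k} (R : Fin N → Bool) prev (cs : Vec ℕ k) ls v → AllPairs _≤_ (prev ∷ cs) →
  T (admissible R prev cs ls v) → All (T ∘ R) v × Unique v × Below cs v × Links prev ls v
admissible⇒ R prev []       []       []      _      _   = [] , [] , (λ ()) , tt
admissible⇒ R prev (c ∷ cs) (l ∷ ls) (x ∷ v) sorted adm =
  Rx ∷ All.map (proj₂ ∘ ─⇒) R─x , All.map (proj₁ ∘ ─⇒) R─x ∷ unique ,
  (λ { zero → x<c ; (suc p) → below p }) , linked , links
  where
  ─⇒ = λ {y} → Equivalence.to (T-─ R x y)
  fits = Equivalence.to (T-∧ {(toℕ x <ᵇ limit l prev c) ∧ R x}) adm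
  x<ᵇlimit×Rx = Equivalence.to (T-∧ {toℕ x <ᵇ limit l prev c}) (proj₁ fits)
  x<limit = <ᵇ⇒< (toℕ x) _ (proj₁ x<ᵇlimit×Rx)
  Rx = proj₂ x<ᵇlimit×Rx
  x<c×linked = <limit⇒ l (All.head (AllPairs.head sorted)) x<limit
  x<c = proj₁ x<c×linked
  linked = proj₂ x<c×linked
  rest = admissible⇒ (R ─ x) (toℕ x) cs ls v (sorted-< x<limit (sorted-limit l sorted)) (proj₂ fits)
  R─x = proj₁ rest
  unique = proj₁ (proj₂ rest)
  below = proj₁ (proj₂ (proj₂ rest))
  links = proj₂ (proj₂ (proj₂ rest))

⇒admissible : ∀ {N k} (R : Fin N → Bool) prev (cs : Vec ℕ k) ls v →
  All (T ∘ R) v → Unique v → Below cs v → Links prev ls v → T (admissible R prev cs ls v)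
⇒admissible R prev []       []       []      _         _              _     _ = tt
⇒admissible R prev (c ∷ cs) (l ∷ ls) (x ∷ v) (Rx ∷ Rv) (x∉v ∷ unique) below (linked , links) =
  Equivalence.from T-∧
    ( Equivalence.from T-∧ (<⇒<ᵇ (⇒<limit l (below zero) linked) , Rx)
    , ⇒admissible (R ─ x) (toℕ x) cs ls v
        (All.map (Equivalence.from (T-─ R x _)) (All.zip (x∉v , Rv))) unique (below ∘ suc) links)

-- Pigeonhole arguments

pigeonhole-⊎ : ∀ {a} (g : Fin a ⊎ Fin 1 → Fin a) → ¬ (∀ u v → g u ≡ g v → u ≡ v)
pigeonhole-⊎ {a} g g-injective = m+1+n≰m a (injective⇒≤ {f = g ∘ Fin.splitAt a} λ {i} {j} eq → begin
  i                              ≡⟨ sym (join-splitAt a 1 i) ⟩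
  Fin.join a 1 (Fin.splitAt a i) ≡⟨ cong (Fin.join a 1) (g-injective _ _ eq) ⟩
  Fin.join a 1 (Fin.splitAt a j) ≡⟨ join-splitAt a 1 j ⟩
  j                              ∎)

Within : ℕ → ℕ → ℕ → Set
Within lo a x = lo ≤ x × x < lo + a

module _ {n} (f : Fin n → Fin n) (f-injective : ∀ i j → f i ≡ f j → i ≡ j) where

  interval-overflow : ∀ lo a (e : Fin n) → lo + a ≤ n → ¬ Within lo a (toℕ e) →
    (∀ p → Within lo a (toℕ p) → Within lo a (toℕ (f p))) → ¬ Within lo a (toℕ (f e))
  interval-overflow lo a e lo+a≤n e∉I f[I]⊆I fe∈I = pigeonhole-⊎ g g-injective
    where
    position : Fin a ⊎ Fin 1 → ℕ
    position (inj₁ i) = lo + toℕ i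
    position (inj₂ _) = toℕ e
    pos : Fin a ⊎ Fin 1 → Fin n
    pos (inj₁ i) = Fin.fromℕ< (<-≤-trans (+-monoʳ-< lo (toℕ<n i)) lo+a≤n)
    pos (inj₂ _) = e
    toℕ-pos : ∀ u → toℕ (pos u) ≡ position u
    toℕ-pos (inj₁ i) = toℕ-fromℕ< _
    toℕ-pos (inj₂ _) = refl
    lo+i∈I : ∀ (i : Fin a) → Within lo a (lo + toℕ i)
    lo+i∈I i = m≤m+n lo _ , +-monoʳ-< lo (toℕ<n i)
    f-pos∈I : ∀ u → Within lo a (toℕ (f (pos u)))
    f-pos∈I (inj₁ i) = f[I]⊆I _ (subst (Within lo a) (sym (toℕ-pos (inj₁ i))) (lo+i∈I i))
    f-pos∈I (inj₂ _) = fe∈I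
    position-injective : ∀ u v → position u ≡ position v → u ≡ v
    position-injective (inj₁ i)    (inj₁ j)    eq = cong inj₁ (toℕ-injective (+-cancelˡ-≡ lo _ _ eq))
    position-injective (inj₁ i)    (inj₂ _)    eq = ⊥-elim (e∉I (subst (Within lo a) eq (lo+i∈I i)))
    position-injective (inj₂ _)    (inj₁ j)    eq = ⊥-elim (e∉I (subst (Within lo a) (sym eq) (lo+i∈I j)))
    position-injective (inj₂ zero) (inj₂ zero) _  = refl
    g : Fin a ⊎ Fin 1 → Fin a
    g u = Fin.fromℕ< (subst (toℕ (f (pos u)) ∸ lo <_) (m+n∸m≡n lo a)
                            (∸-monoˡ-< (proj₂ (f-pos∈I u)) (proj₁ (f-pos∈I u))))
    g-injective : ∀ u v → g u ≡ g v → u ≡ v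
    g-injective u v eq = position-injective u v (begin
      position u   ≡⟨ sym (toℕ-pos u) ⟩
      toℕ (pos u)  ≡⟨ cong toℕ (f-injective _ _ (toℕ-injective f-pos≡)) ⟩
      toℕ (pos v)  ≡⟨ toℕ-pos v ⟩
      position v   ∎)
      where
      f-pos≡ : toℕ (f (pos u)) ≡ toℕ (f (pos v))
      f-pos≡ = ∸-cancelʳ-≡ (proj₁ (f-pos∈I u)) (proj₁ (f-pos∈I v))
                 (trans (sym (toℕ-fromℕ< _)) (trans (cong toℕ eq) (toℕ-fromℕ< _)))

  prefix-closed⇒suffix-above : ∀ J → (∀ p → toℕ p ≤ J → toℕ (f p) ≤ J) → ∀ q → J < toℕ q → J < toℕ (f q)
  prefix-closed⇒suffix-above J prefix q J<q = decidable-stable (J <? toℕ (f q)) λ J≮fq →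
    interval-overflow 0 (suc J) q (≤-trans J<q (<⇒≤ (toℕ<n q)))
      (λ (_ , q<1+J) → <⇒≱ J<q (s≤s⁻¹ q<1+J))
      (λ p (_ , p<1+J) → z≤n , s≤s (prefix p (s≤s⁻¹ p<1+J)))
      (z≤n , s≤s (≮⇒≥ J≮fq))

  separated⇒prefix-closed : ∀ J → J < n → (∀ p q → toℕ p ≤ J → J < toℕ q → toℕ (f p) < toℕ (f q)) →
    ∀ p → toℕ p ≤ J → toℕ (f p) ≤ J
  separated⇒prefix-closed J J<n separated p p≤J = decidable-stable (toℕ (f p) ≤? J) λ fp≰J →
    interval-overflow (suc J) (n ∸ suc J) p (≤-reflexive suc-J+[n∸suc-J]≡n)
      (λ (J<p , _) → <⇒≱ J<p p≤J)
      (λ q (J<q , _) → ≤-trans (≰⇒> fp≰J) (<⇒≤ (separated p q p≤J J<q)) , below-n (f q))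
      (≰⇒> fp≰J , below-n (f p))
    where
    suc-J+[n∸suc-J]≡n = m+[n∸m]≡n J<n
    below-n : ∀ x → toℕ x < suc J + (n ∸ suc J)
    below-n x = subst (toℕ x <_) (sym suc-J+[n∸suc-J]≡n) (toℕ<n x)

-- With positions, values and the elements j of Fin m all counted from 0 (j stands for
-- j + 1 ∈ [n-1]), the value at position p must lie below lookup (bounds S) p, which is
-- 1 + the least j ∈ S̄ with p ≤ j, or n if there is none.
bounds : ∀ {m} → Subset m → Vec ℕ (suc m)
bounds []      = 1 ∷ []
bounds (s ∷ S) = suc (leadingTrues (s ∷ S)) ∷ Vec.map suc (bounds S)

lookup-bounds-zero : ∀ {m} (S : Subset m) → lookup (bounds S) zero ≡ suc (leadingTrues S)
lookup-bounds-zero []      = refl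
lookup-bounds-zero (_ ∷ _) = refl

lookup-bounds-suc : ∀ {m} s (S : Subset m) p → lookup (bounds (s ∷ S)) (suc p) ≡ suc (lookup (bounds S) p)
lookup-bounds-suc s S p = lookup-map p suc (bounds S)

leadingTrues≤length : ∀ {k} (bs : Vec Bool k) → leadingTrues bs ≤ k
leadingTrues≤length []           = z≤n
leadingTrues≤length (true  ∷ bs) = s≤s (leadingTrues≤length bs)
leadingTrues≤length (false ∷ bs) = z≤n

bounds≤ : ∀ {m} (S : Subset m) → All (_≤ suc m) (bounds S)
bounds≤ []      = ≤-refl ∷ []
bounds≤ (s ∷ S) = s≤s (leadingTrues≤length (s ∷ S)) ∷ All.map⁺ (All.map s≤s (bounds≤ S))

bounds≥head : ∀ {m} (S : Subset m) → All (suc (leadingTrues S) ≤_) (bounds S)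
bounds≥head []          = ≤-refl ∷ []
bounds≥head (true  ∷ S) = ≤-refl ∷ All.map⁺ (All.map s≤s (bounds≥head S))
bounds≥head (false ∷ S) = ≤-refl ∷ All.map⁺ (All.universal (λ _ → s≤s z≤n) _)

bounds-sorted : ∀ {m} (S : Subset m) → AllPairs _≤_ (bounds S)
bounds-sorted []      = [] ∷ []
bounds-sorted (s ∷ S) = All.tail (bounds≥head (s ∷ S)) ∷ AllPairs.map⁺ (AllPairs.map s≤s (bounds-sorted S))

bounds≤suc-cut : ∀ {m} (S : Subset m) (p : Fin (suc m)) {j} → j ∈ ∁ S → toℕ p ≤ toℕ j →
  lookup (bounds S) p ≤ suc (toℕ j)
bounds≤suc-cut (false ∷ S) zero    here       _         = ≤-refl
bounds≤suc-cut (false ∷ S) zero    (there _)  _         = s≤s z≤n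
bounds≤suc-cut (true  ∷ S) zero    (there j∈) _         =
  s≤s (subst (_≤ suc _) (lookup-bounds-zero S) (bounds≤suc-cut S zero j∈ z≤n))
bounds≤suc-cut (s     ∷ S) (suc p) (there j∈) (s≤s p≤j) =
  subst (_≤ suc (suc _)) (sym (lookup-bounds-suc s S p)) (s≤s (bounds≤suc-cut S p j∈ p≤j))

≤cuts⇒<bounds : ∀ {m} (S : Subset m) (p : Fin (suc m)) v → v ≤ m →
  (∀ j → j ∈ ∁ S → toℕ p ≤ toℕ j → v ≤ toℕ j) → v < lookup (bounds S) p
≤cuts⇒<bounds []          zero    v       v≤0 _   = s≤s v≤0
≤cuts⇒<bounds (false ∷ S) zero    v       _   v≤ = s≤s (v≤ zero here z≤n)
≤cuts⇒<bounds (true  ∷ S) zero    zero    _   _  = s≤s z≤n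
≤cuts⇒<bounds (true  ∷ S) zero    (suc v) v≤m v≤ =
  s≤s (subst (v <_) (lookup-bounds-zero S)
             (≤cuts⇒<bounds S zero v (s≤s⁻¹ v≤m) λ j j∈ _ → s≤s⁻¹ (v≤ (suc j) (there j∈) z≤n)))
≤cuts⇒<bounds (s     ∷ S) (suc p) zero    _   _  = subst (0 <_) (sym (lookup-bounds-suc s S p)) (s≤s z≤n)
≤cuts⇒<bounds (s     ∷ S) (suc p) (suc v) v≤m v≤ =
  subst (suc v <_) (sym (lookup-bounds-suc s S p))
        (s≤s (≤cuts⇒<bounds S p v (s≤s⁻¹ v≤m) λ j j∈ p≤j → s≤s⁻¹ (v≤ (suc j) (there j∈) (s≤s p≤j))))

gapProduct : ∀ {k} → ℕ → Vec ℕ k → ℕ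
gapProduct s []       = 1
gapProduct s (c ∷ cs) = (c ∸ s) * gapProduct (suc s) cs

gapProduct-map-suc : ∀ {k} s (cs : Vec ℕ k) → gapProduct (suc s) (Vec.map suc cs) ≡ gapProduct s cs
gapProduct-map-suc s []       = refl
gapProduct-map-suc s (c ∷ cs) = cong ((c ∸ s) *_) (gapProduct-map-suc (suc s) cs)

gapProduct-bounds : ∀ {m} (S : Subset m) → gapProduct 0 (bounds S) ≡ runFactorials (false ∷ S)
gapProduct-bounds []      = refl
gapProduct-bounds (s ∷ S) =
  cong (suc (leadingTrues (s ∷ S)) *_) (trans (gapProduct-map-suc 0 (bounds S)) (gapProduct-bounds S))

RunsConstant : ∀ {k} → ℕ → Vec ℕ k → Vec Bool k → Set
RunsConstant β []       []       = ⊤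
RunsConstant β (c ∷ cs) (l ∷ ls) = (T l → β ≡ c) × RunsConstant c cs ls

limit-≡ : ∀ l {β c} → (T l → β ≡ c) → limit l β c ≡ c
limit-≡ true  β≡c = β≡c tt
limit-≡ false _   = refl

choices-constantRuns : ∀ {k} {κ : ℕ → ℕ} β s (cs : Vec ℕ k) ls →
  RunsConstant β cs ls → All (λ c → κ c ≡ c) cs → choices κ β s cs ls ≡ gapProduct s cs
choices-constantRuns β s []       []       _          []         = refl
choices-constantRuns {κ = κ} β s (c ∷ cs) (l ∷ ls) (β≡c , rc) (κc ∷ κcs) =
  trans (cong (λ b → (κ b ∸ s) * choices κ b (suc s) cs ls) (limit-≡ l β≡c))
        (cong₂ _*_ (cong (_∸ s) κc) (choices-constantRuns c (suc s) cs ls rc κcs))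

runsConstant-map-suc : ∀ {k} β (cs : Vec ℕ k) ls →
  RunsConstant β cs ls → RunsConstant (suc β) (Vec.map suc cs) ls
runsConstant-map-suc β []       []       _          = tt
runsConstant-map-suc β (c ∷ cs) (l ∷ ls) (β≡c , rc) = cong suc ∘ β≡c , runsConstant-map-suc c cs ls rc

runsConstant-bounds : ∀ {m} (S D : Subset m) l β → (T l → β ≡ suc (leadingTrues S)) → Empty (∁ S ∩ D) →
  RunsConstant β (bounds S) (l ∷ D)
runsConstant-bounds []      []      l β β≡ _        = β≡ , tt
runsConstant-bounds (s ∷ S) (t ∷ D) l β β≡ disjoint =
  β≡ , runsConstant-map-suc _ (bounds S) (t ∷ D)
         (runsConstant-bounds S D t (leadingTrues (s ∷ S)) (linked s t disjoint)
                              (λ (j , j∈) → disjoint (suc j , there j∈)))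
  where
  linked : ∀ s t → Empty (∁ (s ∷ S) ∩ (t ∷ D)) → T t → leadingTrues (s ∷ S) ≡ suc (leadingTrues S)
  linked true  true _        _ = refl
  linked false true disjoint _ = ⊥-elim (disjoint (zero , here))

mutual
  etaAux-∁ : ∀ {m} (X : Subset m) r →
    etaAux (∁ X) (suc r) * suc (leadingTrues X) ! ≡ (suc (leadingTrues X) + r) ! * runFactorials (false ∷ X)
  etaAux-∁ []          r = refl
  etaAux-∁ (false ∷ X) r =
    trans (cong (λ e → suc r ! * e * 1) (η-∁ X))
          (solve 2 (λ a b → a :* b :* con 1 := a :* (con 1 :* b)) refl (suc r !) (runFactorials (false ∷ X)))
  etaAux-∁ (true  ∷ X) r = begin
    e * (suc L * L !)            ≡⟨ solve 3 (λ e a b → e :* (a :* b) := a :* (e :* b)) refl e (suc L) (L !) ⟩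
    suc L * (e * L !)            ≡⟨ cong (suc L *_) (etaAux-∁ X (suc r)) ⟩
    suc L * ((L + suc r) ! * ρ)  ≡⟨ cong (λ n → suc L * (n ! * ρ)) (+-suc L r) ⟩
    suc L * (f * ρ)              ≡⟨ solve 3 (λ a f b → a :* (f :* b) := f :* (a :* b)) refl (suc L) f ρ ⟩
    f * (suc L * ρ)              ∎
    where
    L = suc (leadingTrues X)
    f = (suc L + r) !
    e = etaAux (∁ X) (suc (suc r))
    ρ = runFactorials (false ∷ X)

  η-∁ : ∀ {m} (X : Subset m) → η (∁ X) ≡ runFactorials (false ∷ X)
  η-∁ X = *-cancelʳ-≡ _ _ (L !) {{L !≢0}}
    (trans (etaAux-∁ X 0)
           (trans (cong (λ n → n ! * runFactorials (false ∷ X)) (+-identityʳ L)) (*-comm (L !) _)))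
    where L = suc (leadingTrues X)

module _ {m} (S : Subset m) (w : Vec (Fin (suc m)) (suc m)) (w-perm : IsPerm w) where

  below-bounds⇒connect : Below (bounds S) w → ∀ j → j ∈ ∁ S → Connect w j
  below-bounds⇒connect below j j∈ p q p≤j j<q =
    ≤-<-trans (prefix p p≤j) (prefix-closed⇒suffix-above (lookup w) w-perm (toℕ j) prefix q j<q)
    where
    prefix : ∀ p → toℕ p ≤ toℕ j → toℕ (lookup w p) ≤ toℕ j
    prefix p p≤j = s≤s⁻¹ (<-≤-trans (below p) (bounds≤suc-cut S p j∈ p≤j))

  connect⇒below-bounds : (∀ j → j ∈ ∁ S → Connect w j) → Below (bounds S) w
  connect⇒below-bounds connect p = ≤cuts⇒<bounds S p _ (s≤s⁻¹ (toℕ<n (lookup w p))) λ j j∈ p≤j →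
    separated⇒prefix-closed (lookup w) w-perm (toℕ j) (m<n⇒m<1+n (toℕ<n j)) (connect j j∈) p p≤j

DescentsAt : ∀ {N k} → Subset k → Vec (Fin N) (suc k) → Set
DescentsAt D v = ∀ j → j ∈ D → toℕ (lookup v (suc j)) < toℕ (lookup v (inject₁ j))

links⇔descents : ∀ {N k} (D : Subset k) (x : Fin N) v → Links (toℕ x) D v ⇔ DescentsAt D (x ∷ v)
links⇔descents []      x []      = mk⇔ (λ _ ()) (λ _ → tt)
links⇔descents (d ∷ D) x (y ∷ v) = mk⇔ to from
  where
  to : Links (toℕ x) (d ∷ D) (y ∷ v) → DescentsAt (d ∷ D) (x ∷ y ∷ v)
  to (y<x , _)     zero    here       = y<x tt
  to (_   , links) (suc j) (there j∈) = Equivalence.to (links⇔descents D y v) links j j∈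
  first : ∀ d → DescentsAt (d ∷ D) (x ∷ y ∷ v) → T d → toℕ y < toℕ x
  first true descents _ = descents zero here
  from : DescentsAt (d ∷ D) (x ∷ y ∷ v) → Links (toℕ x) (d ∷ D) (y ∷ v)
  from descents =
    first d descents , Equivalence.from (links⇔descents D y v) (λ j j∈ → descents (suc j) (there j∈))

perm⇒unique : ∀ {n} (w : Vec (Fin n) n) → IsPerm w → Unique w
perm⇒unique w perm = subst Unique (tabulate∘lookup w) (tabulate⁺ (perm _ _))

admissible⇔permCond : ∀ {m} (S D : Subset m) (w : Vec (Fin (suc m)) (suc m)) →
  T (admissible (λ _ → true) 0 (bounds S) (false ∷ D) w) ⇔ (IsPerm w × Cond S D w)
admissible⇔permCond S D (x ∷ v) = mk⇔ to from
  where
  w = x ∷ v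
  sorted = All.universal (λ _ → z≤n) _ ∷ bounds-sorted S
  to : T (admissible (λ _ → true) 0 (bounds S) (false ∷ D) w) → IsPerm w × Cond S D w
  to adm with _ , unique , below , (_ , links) ← admissible⇒ _ 0 (bounds S) (false ∷ D) w sorted adm =
    perm , below-bounds⇒connect S w perm below , Equivalence.to (links⇔descents D x v) links
    where perm = lookup-injective unique
  from : IsPerm w × Cond S D w → T (admissible (λ _ → true) 0 (bounds S) (false ∷ D) w)
  from (perm , connect , descents) =
    ⇒admissible _ 0 (bounds S) (false ∷ D) w (All.universal (λ _ → tt) _) (perm⇒unique w perm)
      (connect⇒below-bounds S w perm connect) ((λ ()) , Equivalence.from (links⇔descents D x v) descents)

A≡#admissible : ∀ {m} (S D : Subset m) → A S D ≡ #admissible {suc m} (λ _ → true) 0 (bounds S) (false ∷ D)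
A≡#admissible {m} S D = cong length
  (filter-≐ (permCond? S D) (T? ∘ admissible (λ _ → true) 0 (bounds S) (false ∷ D))
            ( (λ {w} → Equivalence.from (admissible⇔permCond S D w))
            , (λ {w} → Equivalence.to (admissible⇔permCond S D w)))
            (allVecs (suc m)))

A*η≡η : ∀ {m} (S D : Subset m) → Empty (∁ S ∩ D) → A S D * η (∁ D) ≡ η (∁ S)
A*η≡η {m} S D disjoint = begin
  A S D * η (∁ D)
    ≡⟨ cong₂ _*_ (A≡#admissible S D) (η-∁ D) ⟩
  #admissible {suc m} (λ _ → true) 0 (bounds S) (false ∷ D) * runFactorials (false ∷ D)
    ≡⟨ #admissible*runFactorials {suc m} _ 0 (bounds S) (false ∷ D)
                                 (All.universal (λ _ → z≤n) _ ∷ bounds-sorted S) ⟩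
  choices (countBelow {suc m} (λ _ → true)) 0 0 (bounds S) (false ∷ D)
    ≡⟨ choices-constantRuns 0 0 (bounds S) (false ∷ D) (runsConstant-bounds S D false 0 (λ ()) disjoint)
                            (All.map (countBelow-full (suc m) _) (bounds≤ S)) ⟩
  gapProduct 0 (bounds S)
    ≡⟨ gapProduct-bounds S ⟩
  runFactorials (false ∷ S)
    ≡⟨ sym (η-∁ S) ⟩
  η (∁ S) ∎

A≡0 : ∀ {m} (S D : Subset m) → Nonempty (∁ S ∩ D) → A S D ≡ 0
A≡0 {m} S D (j , j∈) = cong length (filter-none (permCond? S D) (List.universal impossible (allVecs (suc m))))
  where
  impossible : ∀ w → ¬ (IsPerm w × Cond S D w)
  impossible w (_ , connect , descents) =
    <-asym (connect j (p∩q⊆p (∁ S) D j∈) (inject₁ j) (suc j) (≤-reflexive (toℕ-inject₁ j)) ≤-refl)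
           (descents j (p∩q⊆q (∁ S) D j∈))

theorem1p2 : ∀ (m : ℕ) (S T : Subset m) →
    (Empty (∁ S ∩ T) → A S T ≡ (η (∁ S) / η (∁ T)) {{η-nonZero (∁ T)}})
    × (¬ Empty (∁ S ∩ T) → A S T ≡ 0)
theorem1p2 m S T = disjoint , overlapping
  where
  instance _ = η-nonZero (∁ T)
  disjoint : Empty (∁ S ∩ T) → A S T ≡ η (∁ S) / η (∁ T)
  disjoint empty = trans (sym (m*n/n≡m (A S T) (η (∁ T)))) (cong (_/ η (∁ T)) (A*η≡η S T empty))
  overlapping : ¬ Empty (∁ S ∩ T) → A S T ≡ 0
  overlapping nonEmpty with nonempty? (∁ S ∩ T)
  ... | yes witness = A≡0 S T witness
  ... | no  empty   = ⊥-elim (nonEmpty empty)
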